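{- Let $n\ge2$ and fix $j'\in[n]$, a region $\Delta'$ of $\mathcal{S}_{n-1}^r$, an index $i'\in\{0,1,\ldots,n\}\setminus\{j'\}$, and, if $i'\ne0$, an integer $k'\in[r]$. Then there is at most one region $\Delta$ of $\mathcal{S}_n^r$ such that: - $\mathrm{Proj}_{j'}(\Delta)=\Delta'$; - $p_{j'}(\Delta)=i'$; - $q_{j'}(\Delta)=k'$ (if $i'\ne0$); - $j'\ne p_j(\Delta)$ for all $j\in[n]$.
   Context: The $r$-Shi arrangement $\mathcal{S}_m^r$ in $\mathbb{R}^m$ consists of the hyperplanes $x_i-x_j=a$ for $1\le i<j\le m$ and $a\in\{ -r+1,\ldots,r\}$. Its regions are the connected components of the complement of their union. $\mathrm{Proj}_{j'}:\mathbb{R}^n\to\mathbb{R}^{n-1}$ deletes the $j'$-th coordinate. For a region $\Delta$ of $\mathcal{S}_n^r$ and ${\bm x}\in\Delta$, the cubic matrix $C_{\bm x}=(c_{ijk}({\bm x}))$, with $i,j\in[n]$ and $k\in[r]$, is defined by - $c_{ijk}=x_i-x_j-k$ if $i<j$; - $c_{ijk}=0$ if $i=j$; - $c_{ijk}=x_i-x_j-k+1$ if $i>j$. For $j\in[n]$, put $p_j(\Delta)=0$ if every entry $c_{ijk}({\bm x})$ ($i\in[n]$, $k\in[r]$) of the $j$-th column slice is $\le0$. Otherwise $(p_j(\Delta),q_j(\Delta))$ is the position $(i,k)$ of the unique minimal positive entry $c_{ijk}({\bm x})$ of that column slice. These do not depend on ${\bm x}\in\Delta$.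
   Formalization: Points are taken in ℚ^n and ℚ^(n−1) instead of ℝ^n and ℝ^(n−1), so the regions of $\mathcal{S}_n^r$ and $\mathcal{S}_{n-1}^r$ and $\mathrm{Proj}_{j'}$ are taken over rational points. -}

module Defs where

open import Data.Nat using (ℕ; zero; suc; _<ᵇ_)
open import Data.Integer using (ℤ; +_; -[1+_]) renaming (_≤_ to _≤ℤ_; _-_ to _-ℤ_)
open import Data.Rational using (ℚ; _/_; _-_; _<_; _≤_; 0ℚ)
open import Data.Fin using (Fin; toℕ; punchIn)
open import Data.Bool using (if_then_else_)
open import Data.Maybe using (Maybe; just; nothing)
open import Data.Product using (_×_; Σ; ∃)
open import Relation.Binary.PropositionalEquality using (_≡_; _≢_)
open import Relation.Nullary using (¬_)

-- Points of ℚ^m.  (Every region of the arrangement is open, hence is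
-- determined by its rational points.)
Pt : ℕ → Set
Pt m = Fin m → ℚ

⟦_⟧ : ℤ → ℚ
⟦ a ⟧ = a / 1

InRange : ℕ → ℤ → Set
InRange r a = ((+ 1) -ℤ (+ r) ≤ℤ a) × (a ≤ℤ + r)

Generic : (r : ℕ) {m : ℕ} → Pt m → Set
Generic r x = ∀ i j → toℕ i Data.Nat.< toℕ j → ∀ a → InRange r a → x i - x j ≢ ⟦ a ⟧

SameSide : (r : ℕ) {m : ℕ} → Pt m → Pt m → Set
SameSide r x y = ∀ i j → toℕ i Data.Nat.< toℕ j → ∀ a → InRange r a →
  ((x i - x j < ⟦ a ⟧) → (y i - y j < ⟦ a ⟧)) × ((y i - y j < ⟦ a ⟧) → (x i - x j < ⟦ a ⟧))

-- For a generic point x, the region of 𝒮_m^r containing x is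
-- Reg r x = { y | Generic r y × SameSide r x y }.
InReg : (r : ℕ) {m : ℕ} → Pt m → Pt m → Set
InReg r x y = Generic r y × SameSide r x y

Proj : {m : ℕ} → Fin (suc m) → Pt (suc m) → Pt m
Proj j' w i = w (punchIn j' i)

-- Proj_{j'}(Reg x) = Reg z  (equality of sets)
ProjEq : (r : ℕ) {m : ℕ} → Fin (suc m) → Pt (suc m) → Pt m → Set
ProjEq r j' x z =
  (∀ w → InReg r x w → InReg r z (Proj j' w)) ×
  (∀ u → InReg r z u → ∃ λ w → InReg r x w × (∀ i → Proj j' w i ≡ u i))

-- cubic matrix entry c_{ijk}(x); k ∈ Fin r represents k = toℕ k + 1 ∈ [r]
c : {n r : ℕ} → Pt n → Fin n → Fin n → Fin r → ℚ
c x i j k =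
  if toℕ i <ᵇ toℕ j then x i - x j - ⟦ + suc (toℕ k) ⟧
  else if toℕ j <ᵇ toℕ i then x i - x j - ⟦ + toℕ k ⟧
  else 0ℚ

-- p_j = 0 : every entry of the j-th column slice is ≤ 0
PZero : {n r : ℕ} → Pt n → Fin n → Set
PZero {n} {r} x j = ∀ (i : Fin n) (k : Fin r) → c x i j k ≤ 0ℚ

-- (p_j, q_j) = (i, k): c_{ijk} is the (unique) minimal positive entry of slice j
PQIs : {n r : ℕ} → Pt n → Fin n → Fin n → Fin r → Set
PQIs {n} {r} x j i k =
  (0ℚ < c x i j k) ×
  (∀ (i₂ : Fin n) (k₂ : Fin r) → 0ℚ < c x i₂ j k₂ → c x i j k ≤ c x i₂ j k₂)

-- p_j(x) = i  (i ∈ [n], i.e. not 0)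
PIs : {n : ℕ} (r : ℕ) → Pt n → Fin n → Fin n → Set
PIs r x j i = Σ (Fin r) λ k → PQIs x j i k

-- The prescribed data for column j': nothing means p_{j'} = 0;
-- just (i', k') means p_{j'} = i' and q_{j'} = k'.
PQData : {n : ℕ} (r : ℕ) → Pt n → Fin n → Maybe (Fin n × Fin r) → Set
PQData r x j' nothing = PZero {r = r} x j'
PQData r x j' (just (i' Data.Product., k')) = PQIs x j' i' k'

NotJ : {n r : ℕ} → Fin n → Maybe (Fin n × Fin r) → Set
NotJ j' nothing = Data.Unit.⊤ where import Data.Unit
NotJ j' (just (i' Data.Product., _)) = i' ≢ j'

Conds : (r : ℕ) {m : ℕ} → Fin (suc m) → Pt m → Maybe (Fin (suc m) × Fin r) → Pt (suc m) → Set
Conds r j' z d x =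
  Generic r x × ProjEq r j' x z × PQData r x j' d × (∀ j → ¬ PIs r x j j')

{-# OPTIONS --safe #-}
module Submission where

-- Both x and y project into Δ', so they lie on the same side of every
-- hyperplane avoiding coordinate j'.  The hyperplanes x_i - x_{j'} = a are exactly the
-- zero sets of the entries c_{ij'k} (column j') and c_{j'ik} (row j') of the cubic
-- matrix, so it suffices that no such entry is positive at x and negative at y.
-- For column j' this would contradict the prescribed (p_{j'}, q_{j'}): the minimal
-- positive entry of that column would change order with another entry, i.e. cross a
-- hyperplane avoiding j'.  For row j', take such an entry c_{j'lk} with the least
-- value at x.  Since p_l(x) ≠ j', column l has a positive entry c_{ilk'} below it, and
-- c_{ilk'} = c_{j'lk} is a hyperplane through coordinates i and j' separating x from y;
-- it yields either a column-j' entry changing sign or a row-j' entry with smaller value.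

open import Defs
open import Data.Nat using (ℕ; suc; _≤_)
open import Data.Fin using (Fin)
open import Data.Maybe using (Maybe)
open import Data.Product using (_×_)

open import Algebra.Bundles using (CommutativeMonoid)
open import Data.Bool using (true; false; if_then_else_)
open import Data.Bool.Properties using (T-≡; ¬-not)
open import Data.Empty using (⊥-elim)
open import Data.Fin as Fin using (toℕ; punchIn; fromℕ<; _≟_)
import Data.Fin.Properties as Fin
open import Data.Integer as ℤ using (ℤ; +_; -[1+_])
import Data.Integer.Properties as ℤ
import Data.Integer.Tactic.RingSolver as ℤ-Solver
open import Data.List using (List; allFin; cartesianProduct; filter)
open import Data.List.Membership.Propositional using (_∈_)
open import Data.List.Membership.Propositional.Properties using (∈-filter⁺; ∈-cartesianProduct⁺; ∈-allFin)
import Data.List.Relation.Unary.All as All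
open import Data.List.Relation.Unary.All.Properties using (all-filter)
open import Data.Maybe using (just; nothing)
import Data.Nat as ℕ
import Data.Nat.Properties as ℕ
open import Data.Product using (∃; ∃₂; _,_; proj₁; proj₂; swap)
open import Data.Product.Function.NonDependent.Propositional using (_×-⇔_)
open import Data.Rational as ℚ using (ℚ; 0ℚ; _+_; _-_; -_; _<_)
import Data.Rational.Properties as ℚ
import Data.Rational.Unnormalised as ℚᵘ
import Data.Rational.Unnormalised.Properties as ℚᵘ
open import Data.Sum using (_⊎_; inj₁; inj₂; [_,_]′)
open import Function.Base using (_∘_; id; const)
open import Function.Bundles using (_⇔_; mk⇔; Equivalence)
open import Level using (0ℓ)
open import Relation.Binary.Bundles using (DecTotalOrder)
open import Relation.Binary.Definitions using (tri<; tri≈; tri>)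
open import Relation.Binary.PropositionalEquality
open import Relation.Nullary using (¬_; ¬?; Dec; yes; no)
open import Relation.Nullary.Decidable using (_→-dec_; _×-dec_; decidable-stable)
open import Relation.Unary using (Pred; Decidable)

open import Algebra.Properties.AbelianGroup ℚ.+-0-abelianGroup
  using (//-rightDividesˡ) renaming (⁻¹-involutive to neg-involutive; ⁻¹-anti-homo‿- to -[p-q]≡q-p)
open import Algebra.Properties.CommutativeSemigroup (CommutativeMonoid.commutativeSemigroup ℚ.+-0-commutativeMonoid)
  using (interchange)

p-q+q≡p : ∀ p q → p - q + q ≡ p
p-q+q≡p p q = //-rightDividesˡ q p

p-q-[s-t]≡p-s-[q-t] : ∀ p q s t → p - q - (s - t) ≡ p - s - (q - t)
p-q-[s-t]≡p-s-[q-t] p q s t = begin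
  p - q + - (s - t)      ≡⟨ cong (λ u → p - q + u) (ℚ.neg-distrib-+ s (- t)) ⟩
  p - q + (- s + - - t)  ≡⟨ interchange p (- q) (- s) (- - t) ⟩
  p - s + (- q + - - t)  ≡⟨ cong (λ u → p - s + u) (ℚ.neg-distrib-+ q (- t)) ⟨
  p - s - (q - t)        ∎
  where open ≡-Reasoning

p<q⇒0<q-p : ∀ {p q} → p < q → 0ℚ < q - p
p<q⇒0<q-p {p} {q} p<q = subst (_< q - p) (ℚ.+-inverseʳ p) (ℚ.+-monoˡ-< (- p) p<q)

0<q-p⇒p<q : ∀ {p q} → 0ℚ < q - p → p < q
0<q-p⇒p<q {p} {q} 0<q-p = subst₂ _<_ (ℚ.+-identityˡ p) (p-q+q≡p q p) (ℚ.+-monoˡ-< p 0<q-p)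

p<q⇒p-q<0 : ∀ {p q} → p < q → p - q < 0ℚ
p<q⇒p-q<0 {p} {q} p<q = subst (p - q <_) (ℚ.+-inverseʳ q) (ℚ.+-monoˡ-< (- q) p<q)

p-q<0⇒p<q : ∀ {p q} → p - q < 0ℚ → p < q
p-q<0⇒p<q {p} {q} p-q<0 = subst₂ _<_ (p-q+q≡p p q) (ℚ.+-identityˡ q) (ℚ.+-monoˡ-< q p-q<0)

0<p⇒-p<0 : ∀ {p} → 0ℚ < p → - p < 0ℚ
0<p⇒-p<0 = ℚ.neg-antimono-<

p<0⇒0<-p : ∀ {p} → p < 0ℚ → 0ℚ < - p
p<0⇒0<-p = ℚ.neg-antimono-<

-p<0⇒0<p : ∀ {p} → - p < 0ℚ → 0ℚ < p
-p<0⇒0<p {p} = subst (0ℚ <_) (neg-involutive p) ∘ ℚ.neg-antimono-<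

0<-p⇒p<0 : ∀ {p} → 0ℚ < - p → p < 0ℚ
0<-p⇒p<0 {p} = subst (_< 0ℚ) (neg-involutive p) ∘ ℚ.neg-antimono-<

0<q⇒p-q<p : ∀ {p q} → 0ℚ < q → p - q < p
0<q⇒p-q<p {p} {q} 0<q = subst (p - q <_) (ℚ.+-identityʳ p) (ℚ.+-monoʳ-< p (0<p⇒-p<0 0<q))

p-q≡0⇒p≡q : ∀ {p q} → p - q ≡ 0ℚ → p ≡ q
p-q≡0⇒p≡q {p} {q} p-q≡0 = trans (sym (p-q+q≡p p q)) (trans (cong (_+ q) p-q≡0) (ℚ.+-identityˡ q))

pos-or-neg : ∀ {p} → p ≢ 0ℚ → 0ℚ < p ⊎ p < 0ℚ
pos-or-neg {p} p≢0 with ℚ.<-cmp p 0ℚ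
... | tri< p<0 _ _ = inj₂ p<0
... | tri≈ _ p≡0 _ = ⊥-elim (p≢0 p≡0)
... | tri> _ _ 0<p = inj₁ 0<p

⟦⟧-+ : ∀ a b → ⟦ a ℤ.+ b ⟧ ≡ ⟦ a ⟧ + ⟦ b ⟧
⟦⟧-+ a b = ℚ.toℚᵘ-injective (begin
    ℚ.toℚᵘ ⟦ a ℤ.+ b ⟧              ≈⟨ ℚ.toℚᵘ-fromℚᵘ (ℚᵘ.mkℚᵘ (a ℤ.+ b) 0) ⟩
    ℚᵘ.mkℚᵘ (a ℤ.+ b) 0             ≈⟨ ℚᵘ.*≡* (ℤ-identity a b) ⟩
    ℚᵘ.mkℚᵘ a 0 ℚᵘ.+ ℚᵘ.mkℚᵘ b 0    ≈⟨ ℚᵘ.+-cong (ℚ.toℚᵘ-fromℚᵘ (ℚᵘ.mkℚᵘ a 0)) (ℚ.toℚᵘ-fromℚᵘ (ℚᵘ.mkℚᵘ b 0)) ⟨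
    ℚ.toℚᵘ ⟦ a ⟧ ℚᵘ.+ ℚ.toℚᵘ ⟦ b ⟧  ≈⟨ ℚ.toℚᵘ-homo-+ ⟦ a ⟧ ⟦ b ⟧ ⟨
    ℚ.toℚᵘ (⟦ a ⟧ + ⟦ b ⟧)          ∎)
  where
  open import Relation.Binary.Reasoning.Setoid ℚᵘ.≃-setoid
  ℤ-identity : ∀ a b → (a ℤ.+ b) ℤ.* + 1 ≡ (a ℤ.* + 1 ℤ.+ b ℤ.* + 1) ℤ.* + 1
  ℤ-identity = ℤ-Solver.solve-∀

⟦⟧-neg : ∀ a → ⟦ ℤ.- a ⟧ ≡ - ⟦ a ⟧
⟦⟧-neg (+ 0)     = refl
⟦⟧-neg (+ suc n) = refl
⟦⟧-neg -[1+ n ]  = sym (neg-involutive ⟦ + suc n ⟧)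

⟦⟧-sub : ∀ a b → ⟦ a ℤ.- b ⟧ ≡ ⟦ a ⟧ - ⟦ b ⟧
⟦⟧-sub a b = trans (⟦⟧-+ a (ℤ.- b)) (cong (λ q → ⟦ a ⟧ + q) (⟦⟧-neg b))

[+a]-[+b]≤[+c]-[+d]⇔a+d≤c+b : ∀ a b c d → (+ a ℤ.- + b ℤ.≤ + c ℤ.- + d) ⇔ (a ℕ.+ d ≤ c ℕ.+ b)
[+a]-[+b]≤[+c]-[+d]⇔a+d≤c+b a b c d = mk⇔
  (λ h → ℤ.drop‿+≤+ (ℤ.0≤i-j⇒j≤i (subst (+ 0 ℤ.≤_) difference (ℤ.i≤j⇒0≤j-i h))))
  (λ h → ℤ.0≤i-j⇒j≤i (subst (+ 0 ℤ.≤_) (sym difference) (ℤ.i≤j⇒0≤j-i (ℤ.+≤+ h))))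
  where
  ℤ-identity : ∀ a b c d → c ℤ.- d ℤ.- (a ℤ.- b) ≡ c ℤ.+ b ℤ.- (a ℤ.+ d)
  ℤ-identity = ℤ-Solver.solve-∀
  difference : + c ℤ.- + d ℤ.- (+ a ℤ.- + b) ≡ + (c ℕ.+ b) ℤ.- + (a ℕ.+ d)
  difference = trans (ℤ-identity (+ a) (+ b) (+ c) (+ d)) (sym (cong₂ ℤ._-_ (ℤ.pos-+ c b) (ℤ.pos-+ a d)))

inRange-sub⇔ : ∀ {r p q} → InRange r (+ p ℤ.- + q) ⇔ (q ℕ.< p ℕ.+ r × p ≤ q ℕ.+ r)
inRange-sub⇔ {r} {p} {q} = [+a]-[+b]≤[+c]-[+d]⇔a+d≤c+b 1 r p q ×-⇔ upper
  where
  r-0 : + r ℤ.- + 0 ≡ + r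
  r-0 = ℤ.+-identityʳ (+ r)
  upper : (+ p ℤ.- + q ℤ.≤ + r) ⇔ (p ≤ q ℕ.+ r)
  upper = mk⇔
    (subst₂ _≤_ (ℕ.+-identityʳ p) (ℕ.+-comm r q) ∘ Equivalence.to ([+a]-[+b]≤[+c]-[+d]⇔a+d≤c+b p q r 0)
      ∘ subst (+ p ℤ.- + q ℤ.≤_) (sym r-0))
    (subst (+ p ℤ.- + q ℤ.≤_) r-0 ∘ Equivalence.from ([+a]-[+b]≤[+c]-[+d]⇔a+d≤c+b p q r 0)
      ∘ subst₂ _≤_ (sym (ℕ.+-identityʳ p)) (ℕ.+-comm q r))

inRange⇔ : ∀ {r a} → InRange r a ⇔ ((∃ λ (k : Fin r) → a ≡ + suc (toℕ k)) ⊎ (∃ λ (k : Fin r) → a ≡ ℤ.- + toℕ k))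
inRange⇔ {r} {a} = mk⇔ (to a) from
  where
  pos : ∀ n → InRange r (+ n) → n ≤ r
  pos n = proj₂ ∘ Equivalence.to (inRange-sub⇔ {r} {n} {0}) ∘ subst (InRange r) (sym (ℤ.+-identityʳ (+ n)))
  neg : ∀ n → InRange r (ℤ.- + n) → n ℕ.< r
  neg n = proj₁ ∘ Equivalence.to (inRange-sub⇔ {r} {0} {n}) ∘ subst (InRange r) (sym (ℤ.+-identityˡ (ℤ.- + n)))
  to : ∀ a → InRange r a → (∃ λ (k : Fin r) → a ≡ + suc (toℕ k)) ⊎ (∃ λ (k : Fin r) → a ≡ ℤ.- + toℕ k)
  to (+ 0)     h = inj₂ (fromℕ< (neg 0 h) , cong (ℤ.-_ ∘ +_) (sym (Fin.toℕ-fromℕ< (neg 0 h))))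
  to (+ suc n) h = inj₁ (fromℕ< (pos (suc n) h) , cong (+_ ∘ suc) (sym (Fin.toℕ-fromℕ< (pos (suc n) h))))
  to -[1+ n ]  h = inj₂ (fromℕ< (neg (suc n) h) , cong (ℤ.-_ ∘ +_) (sym (Fin.toℕ-fromℕ< (neg (suc n) h))))
  from : (∃ λ (k : Fin r) → a ≡ + suc (toℕ k)) ⊎ (∃ λ (k : Fin r) → a ≡ ℤ.- + toℕ k) → InRange r a
  from (inj₁ (k , refl)) = subst (InRange r) (ℤ.+-identityʳ (+ suc (toℕ k)))
    (Equivalence.from (inRange-sub⇔ {r} {suc (toℕ k)} {0}) (ℕ.s≤s ℕ.z≤n , Fin.toℕ<n k))
  from (inj₂ (k , refl)) = subst (InRange r) (ℤ.+-identityˡ (ℤ.- + toℕ k))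
    (Equivalence.from (inRange-sub⇔ {r} {0} {toℕ k}) (Fin.toℕ<n k , ℕ.z≤n))

-- Finite descent

no-strict-descent : ∀ {A : Set} {P : Pred A 0ℓ} → Decidable P → (f : A → ℚ) (xs : List A) → (∀ t → t ∈ xs) →
                    (∀ {t} → P t → ∃ λ u → P u × f u < f t) → ∀ t → ¬ P t
no-strict-descent P? f xs complete descend t Pt =
  ℚ.<-irrefl refl
    (ℚ.<-≤-trans fu<f[argmin] (All.lookup (f[argmin]≤f[xs] {f = f} t ys) (∈-filter⁺ P? (complete u) Pu)))
  where
  open import Data.List.Extrema (DecTotalOrder.totalOrder ℚ.≤-decTotalOrder)
    using (argmin; argmin-all; f[argmin]≤f[xs])
  ys = filter P? xs
  minimal = descend (argmin-all f Pt (all-filter P? xs))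
  u = proj₁ minimal
  Pu = proj₁ (proj₂ minimal)
  fu<f[argmin] = proj₂ (proj₂ minimal)

-- Heights above the hyperplanes of 𝒮^r

height : {n : ℕ} → Pt n → Fin n → Fin n → ℤ → ℚ
height x i j a = x i - x j - ⟦ a ⟧

height-swap : ∀ {n} (x : Pt n) i j a → height x j i (ℤ.- a) ≡ - height x i j a
height-swap x i j a = begin
  x j - x i - ⟦ ℤ.- a ⟧   ≡⟨ cong (λ u → x j - x i - u) (⟦⟧-neg a) ⟩
  x j - x i - - ⟦ a ⟧     ≡⟨ cong (λ u → x j - x i + u) (neg-involutive ⟦ a ⟧) ⟩
  x j - x i + ⟦ a ⟧       ≡⟨ ℚ.+-comm (x j - x i) ⟦ a ⟧ ⟩
  ⟦ a ⟧ + (x j - x i)     ≡⟨ cong (λ u → ⟦ a ⟧ + u) (-[p-q]≡q-p (x i) (x j)) ⟨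
  ⟦ a ⟧ - (x i - x j)     ≡⟨ -[p-q]≡q-p (x i - x j) ⟦ a ⟧ ⟨
  - height x i j a        ∎
  where open ≡-Reasoning

height-diag : ∀ {n} (x y : Pt n) i a → height x i i a ≡ height y i i a
height-diag x y i a = cong (_- ⟦ a ⟧) (trans (ℚ.+-inverseʳ (x i)) (sym (ℚ.+-inverseʳ (y i))))

Wall : (r : ℕ) {n : ℕ} → Fin n → Fin n → ℤ → Set
Wall r i j a = (toℕ i ℕ.< toℕ j × InRange r a) ⊎ (toℕ j ℕ.< toℕ i × InRange r (ℤ.- a))

wall⇒≢ : ∀ {r n} {i j : Fin n} {a} → Wall r i j a → i ≢ j
wall⇒≢ (inj₁ (i<j , _)) refl = ℕ.<-irrefl refl i<j
wall⇒≢ (inj₂ (j<i , _)) refl = ℕ.<-irrefl refl j<i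

wall-swap : ∀ {r n} {i j : Fin n} {a} → Wall r i j a → Wall r j i (ℤ.- a)
wall-swap {r} {a = a} (inj₁ (i<j , a∈)) = inj₂ (i<j , subst (InRange r) (sym (ℤ.neg-involutive a)) a∈)
wall-swap (inj₂ (j<i , a∈)) = inj₁ (j<i , a∈)

punchIn-cancel-< : ∀ {n} (p : Fin (suc n)) i j → toℕ (punchIn p i) ℕ.< toℕ (punchIn p j) → toℕ i ℕ.< toℕ j
punchIn-cancel-< p i j h = ℕ.≰⇒> (ℕ.<⇒≱ h ∘ Fin.punchIn-mono-≤ p j i)

wall-punchIn⁻ : ∀ {r n} (p : Fin (suc n)) {i j : Fin n} {a} → Wall r (punchIn p i) (punchIn p j) a → Wall r i j a
wall-punchIn⁻ p {i} {j} (inj₁ (i<j , a∈)) = inj₁ (punchIn-cancel-< p i j i<j , a∈)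
wall-punchIn⁻ p {i} {j} (inj₂ (j<i , a∈)) = inj₂ (punchIn-cancel-< p j i j<i , a∈)

-- The cubic matrix

offset : ∀ {n r} → Fin n → Fin n → Fin r → ℕ
offset i j k = if toℕ i ℕ.<ᵇ toℕ j then suc (toℕ k) else toℕ k

<⇒<ᵇ≡true : ∀ {m n} → m ℕ.< n → (m ℕ.<ᵇ n) ≡ true
<⇒<ᵇ≡true = Equivalence.to T-≡ ∘ ℕ.<⇒<ᵇ

≮⇒<ᵇ≡false : ∀ {m n} → ¬ m ℕ.< n → (m ℕ.<ᵇ n) ≡ false
≮⇒<ᵇ≡false {m} {n} m≮n = ¬-not (m≮n ∘ ℕ.<ᵇ⇒< m n ∘ Equivalence.from T-≡)

offset-< : ∀ {n r} {i j : Fin n} (k : Fin r) → toℕ i ℕ.< toℕ j → offset i j k ≡ suc (toℕ k)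
offset-< k i<j rewrite <⇒<ᵇ≡true i<j = refl

offset-≮ : ∀ {n r} {i j : Fin n} (k : Fin r) → ¬ toℕ i ℕ.< toℕ j → offset i j k ≡ toℕ k
offset-≮ k i≮j rewrite ≮⇒<ᵇ≡false i≮j = refl

offset≤ : ∀ {n r} (i j : Fin n) (k : Fin r) → offset i j k ≤ r
offset≤ i j k with toℕ i ℕ.<ᵇ toℕ j
... | true  = Fin.toℕ<n k
... | false = ℕ.<⇒≤ (Fin.toℕ<n k)

offset-mono : ∀ {n r} {i j : Fin n} (l : Fin n) (k k′ : Fin r) → toℕ i ℕ.< toℕ j →
              offset j l k′ ℕ.< offset i l k ℕ.+ r
offset-mono {r = r} {i} {j} l k k′ i<j with toℕ j ℕ.<? toℕ l
... | yes j<l rewrite offset-< k′ j<l | offset-< k (ℕ.<-trans i<j j<l) =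
  ℕ.s≤s (ℕ.≤-trans (Fin.toℕ<n k′) (ℕ.m≤n+m r (toℕ k)))
... | no j≮l rewrite offset-≮ k′ j≮l = ℕ.≤-trans (Fin.toℕ<n k′) (ℕ.m≤n+m r (offset i l k))

c-offDiag : ∀ {n r} (x : Pt n) {i j} (k : Fin r) → i ≢ j → c x i j k ≡ height x i j (+ offset i j k)
c-offDiag x {i} {j} k i≢j with ℕ.<-cmp (toℕ i) (toℕ j)
... | tri< i<j _ _ rewrite <⇒<ᵇ≡true i<j = refl
... | tri≈ _ i≡j _ = ⊥-elim (i≢j (Fin.toℕ-injective i≡j))
... | tri> _ _ j<i rewrite ≮⇒<ᵇ≡false (ℕ.<-asym j<i) | <⇒<ᵇ≡true j<i = refl

c-diag : ∀ {n r} (x : Pt n) i (k : Fin r) → c x i i k ≡ 0ℚ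
c-diag x i k rewrite ≮⇒<ᵇ≡false (ℕ.<-irrefl {toℕ i} refl) = refl

c-transpose : ∀ {n r} (x : Pt n) {i j} (k : Fin r) → i ≢ j → height x i j (ℤ.- + offset j i k) ≡ - c x j i k
c-transpose x {i} {j} k i≢j = trans (height-swap x j i (+ offset j i k)) (cong -_ (sym (c-offDiag x k (i≢j ∘ sym))))

c-sub-sameColumn : ∀ {n r} (x : Pt n) {a b j} (k k′ : Fin r) → a ≢ j → b ≢ j →
                   c x a j k - c x b j k′ ≡ height x a b (+ offset a j k ℤ.- + offset b j k′)
c-sub-sameColumn x {a} {b} {j} k k′ a≢j b≢j = begin
  c x a j k - c x b j k′                     ≡⟨ cong₂ _-_ (c-offDiag x k a≢j) (c-offDiag x k′ b≢j) ⟩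
  height x a j s - height x b j t            ≡⟨ p-q-[s-t]≡p-s-[q-t] (x a - x j) ⟦ s ⟧ (x b - x j) ⟦ t ⟧ ⟩
  x a - x j - (x b - x j) - (⟦ s ⟧ - ⟦ t ⟧)  ≡⟨ cong (_- (⟦ s ⟧ - ⟦ t ⟧)) cancel-x-j ⟩
  x a - x b - (⟦ s ⟧ - ⟦ t ⟧)                ≡⟨ cong (λ u → x a - x b - u) (⟦⟧-sub s t) ⟨
  height x a b (s ℤ.- t)                     ∎
  where
  open ≡-Reasoning
  s t : ℤ
  s = + offset a j k
  t = + offset b j k′
  cancel-x-j : x a - x j - (x b - x j) ≡ x a - x b
  cancel-x-j = trans (p-q-[s-t]≡p-s-[q-t] (x a) (x j) (x b) (x j))
                     (trans (cong (λ u → x a - x b - u) (ℚ.+-inverseʳ (x j))) (ℚ.+-identityʳ (x a - x b)))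

c-sub-sameCell : ∀ {n r} (x y : Pt n) {i j} (k k′ : Fin r) → i ≢ j → c x i j k - c x i j k′ ≡ c y i j k - c y i j k′
c-sub-sameCell x y {i} {j} k k′ i≢j =
  trans (c-sub-sameColumn x k k′ i≢j i≢j)
        (trans (height-diag x y i (+ offset i j k ℤ.- + offset i j k′)) (sym (c-sub-sameColumn y k k′ i≢j i≢j)))

wall-offset : ∀ {r n} {i j : Fin n} (k : Fin r) → i ≢ j → Wall r i j (+ offset i j k)
wall-offset {i = i} {j} k i≢j with ℕ.<-cmp (toℕ i) (toℕ j)
... | tri< i<j _ _ = inj₁ (i<j , Equivalence.from inRange⇔ (inj₁ (k , cong +_ (offset-< k i<j))))
... | tri≈ _ i≡j _ = ⊥-elim (i≢j (Fin.toℕ-injective i≡j))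
... | tri> _ _ j<i = inj₂ (j<i , Equivalence.from inRange⇔ (inj₂ (k , cong (ℤ.-_ ∘ +_) (offset-≮ k (ℕ.<-asym j<i)))))

wall⇒offset : ∀ {r n} {i j : Fin n} {a} → Wall r i j a →
              (∃ λ (k : Fin r) → a ≡ + offset i j k) ⊎ (∃ λ (k : Fin r) → a ≡ ℤ.- + offset j i k)
wall⇒offset (inj₁ (i<j , a∈)) with Equivalence.to inRange⇔ a∈
... | inj₁ (k , a≡) = inj₁ (k , trans a≡ (cong +_ (sym (offset-< k i<j))))
... | inj₂ (k , a≡) = inj₂ (k , trans a≡ (cong (ℤ.-_ ∘ +_) (sym (offset-≮ k (ℕ.<-asym i<j)))))
wall⇒offset {a = a} (inj₂ (j<i , -a∈)) with Equivalence.to inRange⇔ -a∈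
... | inj₁ (k , -a≡) =
  inj₂ (k , ℤ.neg-injective (trans -a≡ (trans (cong +_ (sym (offset-< k j<i))) (sym (ℤ.neg-involutive _)))))
... | inj₂ (k , -a≡) = inj₁ (k , ℤ.neg-injective (trans -a≡ (cong (ℤ.-_ ∘ +_) (sym (offset-≮ k (ℕ.<-asym j<i))))))

wall-offset-sub : ∀ {r n} {i j : Fin n} (l : Fin n) (k k′ : Fin r) → i ≢ j →
                  Wall r i j (+ offset i l k ℤ.- + offset j l k′)
wall-offset-sub {r} {i = i} {j} l k k′ i≢j with ℕ.<-cmp (toℕ i) (toℕ j)
... | tri< i<j _ _ = inj₁ (i<j , Equivalence.from inRange-sub⇔
        (offset-mono l k k′ i<j , ℕ.≤-trans (offset≤ i l k) (ℕ.m≤n+m r _)))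
... | tri≈ _ i≡j _ = ⊥-elim (i≢j (Fin.toℕ-injective i≡j))
... | tri> _ _ j<i = inj₂ (j<i , subst (InRange r) (neg-sub (+ offset j l k′) (+ offset i l k))
        (Equivalence.from inRange-sub⇔ (offset-mono l k′ k j<i , ℕ.≤-trans (offset≤ j l k′) (ℕ.m≤n+m r _))))
  where
  neg-sub : ∀ p q → p ℤ.- q ≡ ℤ.- (q ℤ.- p)
  neg-sub = ℤ-Solver.solve-∀

smaller-positive-entry : ∀ {n r} (x : Pt n) {i j : Fin n} {k : Fin r} → ¬ PIs r x j i → 0ℚ < c x i j k →
                         ∃₂ λ i₂ k₂ → 0ℚ < c x i₂ j k₂ × c x i₂ j k₂ < c x i j k
smaller-positive-entry {n} {r} x {i} {j} {k} notPivot 0<e =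
  let (i₂ , ¬bounded-i₂) = Fin.¬∀⟶∃¬ n _ (λ i₂ → Fin.all? (bounded? i₂)) (λ bounded → notPivot (k , 0<e , bounded))
      (k₂ , ¬bounded) = Fin.¬∀⟶∃¬ r _ (bounded? i₂) ¬bounded-i₂
  in i₂ , k₂ , decidable-stable (0ℚ ℚ.<? c x i₂ j k₂) (λ ¬pos → ¬bounded (⊥-elim ∘ ¬pos))
            , ℚ.≰⇒> (¬bounded ∘ const)
  where
  Bounded : Fin n → Fin r → Set
  Bounded i₂ k₂ = 0ℚ < c x i₂ j k₂ → c x i j k ℚ.≤ c x i₂ j k₂
  bounded? : ∀ i₂ k₂ → Dec (Bounded i₂ k₂)
  bounded? i₂ k₂ = (0ℚ ℚ.<? c x i₂ j k₂) →-dec (c x i j k ℚ.≤? c x i₂ j k₂)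

sameSide-refl : ∀ {r n} (x : Pt n) → SameSide r x x
sameSide-refl x _ _ _ _ _ = id , id

sameSide-sym : ∀ {r n} {x y : Pt n} → SameSide r x y → SameSide r y x
sameSide-sym x~y i j i<j a a∈ = swap (x~y i j i<j a a∈)

sameSide-trans : ∀ {r n} {x y w : Pt n} → SameSide r x y → SameSide r y w → SameSide r x w
sameSide-trans x~y y~w i j i<j a a∈ =
  proj₁ (y~w i j i<j a a∈) ∘ proj₁ (x~y i j i<j a a∈) , proj₂ (x~y i j i<j a a∈) ∘ proj₂ (y~w i j i<j a a∈)

inReg-resp : ∀ {r n} {x y w : Pt n} → SameSide r x y → InReg r x w → InReg r y w
inReg-resp {x = x} {y} {w} x~y (gw , x~w) = gw , sameSide-trans {x = y} {x} {w} (sameSide-sym {x = x} {y} x~y) x~w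

generic⇒height≢0 : ∀ {r n} {x : Pt n} {i j a} → Generic r x → Wall r i j a → height x i j a ≢ 0ℚ
generic⇒height≢0 gx (inj₁ (i<j , a∈)) h≡0 = gx _ _ i<j _ a∈ (p-q≡0⇒p≡q h≡0)
generic⇒height≢0 {x = x} {i} {j} {a} gx (inj₂ (j<i , -a∈)) h≡0 =
  gx j i j<i (ℤ.- a) -a∈ (p-q≡0⇒p≡q (trans (height-swap x i j a) (cong -_ h≡0)))

sameSide-pos : ∀ {r n} {x y : Pt n} {i j a} → Generic r y → SameSide r x y → Wall r i j a →
               0ℚ < height x i j a → 0ℚ < height y i j a
sameSide-pos {y = y} gy x~y w@(inj₁ (i<j , a∈)) 0<hx with pos-or-neg (generic⇒height≢0 {x = y} gy w)
... | inj₁ 0<hy = 0<hy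
... | inj₂ hy<0 = ⊥-elim (ℚ.<-asym 0<hx (p<q⇒p-q<0 (proj₂ (x~y _ _ i<j _ a∈) (p-q<0⇒p<q hy<0))))
sameSide-pos {x = x} {y} {i} {j} {a} gy x~y (inj₂ (j<i , -a∈)) 0<hx =
  -p<0⇒0<p (subst (_< 0ℚ) (height-swap y i j a) hy′<0)
  where
  hx′<0 : height x j i (ℤ.- a) < 0ℚ
  hx′<0 = subst (_< 0ℚ) (sym (height-swap x i j a)) (0<p⇒-p<0 0<hx)
  hy′<0 : height y j i (ℤ.- a) < 0ℚ
  hy′<0 = p<q⇒p-q<0 (proj₁ (x~y j i j<i (ℤ.- a) -a∈) (p-q<0⇒p<q hx′<0))

-- Regions of 𝒮_{m+1}^r projecting into a region of 𝒮_m^r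

module _ {r m : ℕ} {j' : Fin (suc m)} {z : Pt m} (gz : Generic r z) where

  proj-inReg : ∀ {d} {x : Pt (suc m)} → Conds r j' z d x → InReg r z (Proj j' x)
  proj-inReg {x = x} (gx , (proj-⊆ , _) , _) = proj-⊆ x (gx , sameSide-refl x)

  proj-pos : ∀ {x y : Pt (suc m)} {a} → InReg r z (Proj j' x) → InReg r z (Proj j' y) → ∀ i₀ j₀ →
             Wall r (punchIn j' i₀) (punchIn j' j₀) a → 0ℚ < height x (punchIn j' i₀) (punchIn j' j₀) a →
             0ℚ < height y (punchIn j' i₀) (punchIn j' j₀) a
  proj-pos {x} {y} (_ , z~x′) (gy′ , z~y′) i₀ j₀ w =
    sameSide-pos {x = z} {Proj j' y} gy′ z~y′ (wall-punchIn⁻ j' w) ∘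
    sameSide-pos {x = Proj j' x} {z} gz (sameSide-sym {x = z} {Proj j' x} z~x′) (wall-punchIn⁻ j' w)

  wall-pos-off-j' : ∀ {d} {x y : Pt (suc m)} {i j a} → Conds r j' z d x → Conds r j' z d y → i ≢ j' → j ≢ j' →
                    Wall r i j a → 0ℚ < height x i j a → 0ℚ < height y i j a
  wall-pos-off-j' {x = x} {y} {i} {j} {a} Cx Cy i≢j' j≢j' =
    subst₂ (λ i j → Wall r i j a → 0ℚ < height x i j a → 0ℚ < height y i j a)
      (Fin.punchIn-punchOut (i≢j' ∘ sym)) (Fin.punchIn-punchOut (j≢j' ∘ sym))
      (proj-pos {x} {y} {a} (proj-inReg Cx) (proj-inReg Cy) _ _)

  no-columnFlip : ∀ {d} {x y : Pt (suc m)} {l} {k : Fin r} → NotJ j' d → Conds r j' z d x → Conds r j' z d y →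
                  l ≢ j' → 0ℚ < c x l j' k → ¬ c y l j' k < 0ℚ
  no-columnFlip {nothing} {l = l} {k} _ (_ , _ , x-nonpos , _) _ _ 0<cx _ =
    ℚ.<-irrefl refl (ℚ.<-≤-trans 0<cx (x-nonpos l k))
  no-columnFlip {just (i' , k')} {x} {y} {l} {k}
                i'≢j' Cx@(_ , _ , (_ , x-min) , _) Cy@(_ , _ , (0<cy′ , _) , _) l≢j' 0<cx cy<0 =
    ℚ.<-irrefl refl (ℚ.<-≤-trans (0<q-p⇒p<q (0<Dx (i' ≟ l))) (x-min l k 0<cx))
    where
    0<Dy : 0ℚ < c y i' j' k' - c y l j' k
    0<Dy = p<q⇒0<q-p (ℚ.<-trans cy<0 0<cy′)
    0<Dx : Dec (i' ≡ l) → 0ℚ < c x i' j' k' - c x l j' k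
    0<Dx (yes refl) = subst (0ℚ <_) (c-sub-sameCell y x k' k l≢j') 0<Dy
    0<Dx (no i'≢l)  = subst (0ℚ <_) (sym (c-sub-sameColumn x k' k i'≢j' l≢j'))
                        (wall-pos-off-j' {just (i' , k')} {y} {x} Cy Cx i'≢j' l≢j' (wall-offset-sub j' k' k i'≢l)
                          (subst (0ℚ <_) (c-sub-sameColumn y k' k i'≢j' l≢j') 0<Dy))

  module _ {d : Maybe (Fin (suc m) × Fin r)} (d-ok : NotJ j' d) where

    Cond : Pt (suc m) → Set
    Cond = Conds r j' z d

    rowEntry : Pt (suc m) → Fin (suc m) × Fin r → ℚ
    rowEntry x (l , k) = c x j' l k

    RowFlip : Pt (suc m) → Pt (suc m) → Fin (suc m) × Fin r → Set
    RowFlip x y t = proj₁ t ≢ j' × 0ℚ < rowEntry x t × rowEntry y t < 0ℚ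

    RowFlip? : ∀ x y → Decidable (RowFlip x y)
    RowFlip? x y (l , k) = ¬? (l ≟ j') ×-dec (0ℚ ℚ.<? c x j' l k) ×-dec (c y j' l k ℚ.<? 0ℚ)

    separating-wall⇒rowFlip : ∀ {x y i a} → Cond x → Cond y → i ≢ j' → Wall r i j' a →
                              height x i j' a < 0ℚ → 0ℚ < height y i j' a →
                              ∃ λ k → RowFlip x y (i , k) × c x j' i k ≡ - height x i j' a
    separating-wall⇒rowFlip {x} {y} {i} {a} Cx Cy i≢j' w hx<0 0<hy = [ ⊥-elim ∘ column , row ]′ (wall⇒offset w)
      where
      column : ¬ ∃ λ k → a ≡ + offset i j' k
      column (k , a≡) =
        no-columnFlip {x = y} {x} {k = k} d-ok Cy Cx i≢j'
          (subst (0ℚ <_) (entry y) 0<hy) (subst (_< 0ℚ) (entry x) hx<0)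
        where
        entry : ∀ u → height u i j' a ≡ c u i j' k
        entry u = trans (cong (height u i j') a≡) (sym (c-offDiag u k i≢j'))
      row : (∃ λ k → a ≡ ℤ.- + offset j' i k) → ∃ λ k → RowFlip x y (i , k) × c x j' i k ≡ - height x i j' a
      row (k , a≡) =
        k , (i≢j' , -p<0⇒0<p (subst (_< 0ℚ) (entry x) hx<0) , 0<-p⇒p<0 (subst (0ℚ <_) (entry y) 0<hy))
          , sym (trans (cong -_ (entry x)) (neg-involutive (c x j' i k)))
        where
        entry : ∀ u → height u i j' a ≡ - c u j' i k
        entry u = trans (cong (height u i j') a≡) (c-transpose u k i≢j')

    rowFlip-descent : ∀ {x y} → Cond x → Cond y → ∀ {t} → RowFlip x y t →
                      ∃ λ u → RowFlip x y u × rowEntry x u < rowEntry x t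
    rowFlip-descent {x} {y} Cx@(_ , _ , _ , x-notPivot) Cy {l , k} (l≢j' , 0<X , Y<0) =
      let (i , k₂ , 0<P , P<X) = smaller-positive-entry x {j'} {l} {k} (x-notPivot l) 0<X
      in through {i} {k₂} (i ≟ l) (i ≟ j') 0<P P<X
      where
      through : ∀ {i k₂} → Dec (i ≡ l) → Dec (i ≡ j') → 0ℚ < c x i l k₂ → c x i l k₂ < c x j' l k →
                ∃ λ u → RowFlip x y u × rowEntry x u < c x j' l k
      through {k₂ = k₂} (yes refl) _ 0<P _ = ⊥-elim (ℚ.<-irrefl (sym (c-diag x l k₂)) 0<P)
      through {k₂ = k₂} (no _) (yes refl) 0<P P<X = (l , k₂) , (l≢j' , 0<P , ℚ.<-trans cy₂<cy Y<0) , P<X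
        where
        cy₂<cy : c y j' l k₂ < c y j' l k
        cy₂<cy = p-q<0⇒p<q {c y j' l k₂} (subst (_< 0ℚ) (c-sub-sameCell x y k₂ k (l≢j' ∘ sym)) (p<q⇒p-q<0 P<X))
      through {i} {k₂} (no i≢l) (no i≢j') 0<P P<X =
        let (k₃ , flip , cx≡) = separating-wall⇒rowFlip Cx Cy i≢j' (wall-offset-sub l k₂ k i≢j') hx<0 0<hy
        in (i , k₃) , flip , below-X cx≡
        where
        w = + offset i l k₂ ℤ.- + offset j' l k
        Dx≡ : c x i l k₂ - c x j' l k ≡ height x i j' w
        Dx≡ = c-sub-sameColumn x k₂ k i≢l (l≢j' ∘ sym)
        hx<0 : height x i j' w < 0ℚ
        hx<0 = subst (_< 0ℚ) Dx≡ (p<q⇒p-q<0 P<X)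
        0<Py : 0ℚ < c y i l k₂
        0<Py = subst (0ℚ <_) (sym (c-offDiag y k₂ i≢l))
                 (wall-pos-off-j' Cx Cy i≢j' l≢j' (wall-offset k₂ i≢l) (subst (0ℚ <_) (c-offDiag x k₂ i≢l) 0<P))
        0<hy : 0ℚ < height y i j' w
        0<hy = subst (0ℚ <_) (c-sub-sameColumn y k₂ k i≢l (l≢j' ∘ sym)) (p<q⇒0<q-p (ℚ.<-trans Y<0 0<Py))
        below-X : ∀ {e} → e ≡ - height x i j' w → e < c x j' l k
        below-X refl = subst (_< c x j' l k) (trans (sym (-[p-q]≡q-p (c x i l k₂) (c x j' l k))) (cong -_ Dx≡))
                             (0<q⇒p-q<p {c x j' l k} 0<P)

    no-rowFlip : ∀ {x y} → Cond x → Cond y → ∀ t → ¬ RowFlip x y t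
    no-rowFlip {x} {y} Cx Cy =
      no-strict-descent (RowFlip? x y) (rowEntry x) (cartesianProduct (allFin (suc m)) (allFin r))
        (λ (l , k) → ∈-cartesianProduct⁺ (∈-allFin l) (∈-allFin k)) (λ {t} → rowFlip-descent Cx Cy {t})

    wall-pos-to-j' : ∀ {x y i a} → Cond x → Cond y → i ≢ j' → Wall r i j' a →
                     0ℚ < height x i j' a → 0ℚ < height y i j' a
    wall-pos-to-j' {x} {y} {i} {a} Cx Cy@(gy , _) i≢j' w 0<hx =
      [ id , ⊥-elim ∘ no-flip ]′ (pos-or-neg (generic⇒height≢0 {x = y} gy w))
      where
      no-flip : ¬ height y i j' a < 0ℚ
      no-flip hy<0 =
        let (k , flip , _) = separating-wall⇒rowFlip Cy Cx i≢j' w hy<0 0<hx in no-rowFlip Cy Cx (i , k) flip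

    wall-pos-from-j' : ∀ {x y j a} → Cond x → Cond y → j ≢ j' → Wall r j' j a →
                       0ℚ < height x j' j a → 0ℚ < height y j' j a
    wall-pos-from-j' {x} {y} {j} {a} Cx Cy@(gy , _) j≢j' w 0<hx =
      [ id , ⊥-elim ∘ no-flip ]′ (pos-or-neg (generic⇒height≢0 {x = y} gy w))
      where
      no-flip : ¬ height y j' j a < 0ℚ
      no-flip hy<0 =
        ℚ.<-asym (subst (_< 0ℚ) (sym (height-swap x j' j a)) (0<p⇒-p<0 0<hx))
                 (wall-pos-to-j' Cy Cx j≢j' (wall-swap w) (subst (0ℚ <_) (sym (height-swap y j' j a)) (p<0⇒0<-p hy<0)))

    wall-pos : ∀ {x y i j a} → Cond x → Cond y → Wall r i j a → 0ℚ < height x i j a → 0ℚ < height y i j a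
    wall-pos {i = i} {j} = by-cases (i ≟ j') (j ≟ j')
      where
      by-cases : ∀ {x y i j a} → Dec (i ≡ j') → Dec (j ≡ j') → Cond x → Cond y → Wall r i j a →
                 0ℚ < height x i j a → 0ℚ < height y i j a
      by-cases (yes refl) (yes refl) _  _  w = ⊥-elim (wall⇒≢ w refl)
      by-cases (no i≢j')  (yes refl) Cx Cy w = wall-pos-to-j' Cx Cy i≢j' w
      by-cases (yes refl) (no j≢j')  Cx Cy w = wall-pos-from-j' Cx Cy j≢j' w
      by-cases (no i≢j')  (no j≢j')  Cx Cy w = wall-pos-off-j' Cx Cy i≢j' j≢j' w

    conds⇒sameSide : ∀ {x y} → Cond x → Cond y → SameSide r x y
    conds⇒sameSide Cx Cy i j i<j a a∈ = below Cx Cy , below Cy Cx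
      where
      below : ∀ {u v} → Cond u → Cond v → u i - u j < ⟦ a ⟧ → v i - v j < ⟦ a ⟧
      below {u} {v} Cu Cv =
        p-q<0⇒p<q ∘ 0<-p⇒p<0 ∘ subst (0ℚ <_) (height-swap v i j a) ∘
        wall-pos Cu Cv (wall-swap (inj₁ (i<j , a∈))) ∘
        subst (0ℚ <_) (sym (height-swap u i j a)) ∘ p<0⇒0<-p ∘ p<q⇒p-q<0

lemma4p4 : (r m : ℕ) → 1 ≤ m → (j' : Fin (suc m)) → (z : Pt m) → Generic r z →
    (d : Maybe (Fin (suc m) × Fin r)) → NotJ j' d →
    (x y : Pt (suc m)) → Conds r j' z d x → Conds r j' z d y →
    (∀ w → InReg r x w → InReg r y w) × (∀ w → InReg r y w → InReg r x w)
lemma4p4 r m _ j' z gz d d-ok x y Cx Cy =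
  (λ w → inReg-resp {x = x} {y} {w} (conds⇒sameSide {z = z} gz d-ok Cx Cy)) ,
  (λ w → inReg-resp {x = y} {x} {w} (conds⇒sameSide {z = z} gz d-ok Cy Cx))
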